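{- Let $G$ be a directed multigraph with $n$ vertices, $m$ edges and no self-loops, let $k$ be a positive integer, let $p\ge 2m^5$ be a prime, and let $K=\sum_{i=1}^k L_iR_i$ be the random $m\times m$ matrix over $\mathbb{F}_p$ described below. Then $\det(I-K)\neq 0$ with probability at least $1-1/m^3$.
   Context: For an edge $e=(u,v)$, $u$ is its tail and $v$ its head. For each $i\in[k]$, $L_i$ is an $m\times n$ matrix over $\mathbb{F}_p$ with rows indexed by edges and columns by vertices, where for each edge $e=(u,v)$ the entry $L_i[e,v]$ is an independent uniformly random element of $\mathbb{F}_p$, and all other entries are $0$. Similarly $R_i$ is an $n\times m$ matrix with rows indexed by vertices and columns by edges, where for each edge $f=(u,v)$ the entry $R_i[u,f]$ is an independent uniformly random element of $\mathbb{F}_p$, and all other entries are $0$. All these random entries are mutually independent. Equivalently $K=LR$ where $L$ is the $m\times kn$ horizontal concatenation of $L_1,\dots,L_k$ and $R$ is the $kn\times m$ vertical concatenation of $R_1,\dots,R_k$. -}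

module Defs where

open import Data.Nat using (ℕ; zero; suc; _+_; _*_; _∸_; NonZero)
open import Data.Nat.DivMod using (_mod_)
open import Data.Fin using (Fin; toℕ; punchIn; _≟_)
open import Data.List.Base using (allFin)
open import Relation.Binary.PropositionalEquality using (_≢_)
import Data.Fin as F
open import Data.List using (List; []; _∷_; map; concatMap; filter; length)
open import Data.Vec.Functional using (Vector)
import Data.Vec.Functional as VF
open import Data.Product using (_×_; _,_)
open import Relation.Nullary using (does)
open import Data.Bool using (if_then_else_)
import Data.Vec as Vec

allFns : {A : Set} → List A → (n : ℕ) → List (Vector A n)
allFns xs zero    = (λ ()) ∷ []
allFns xs (suc n) = concatMap (λ x → map (λ f → x VF.∷ f) (allFns xs n)) xs

pairs : {A B : Set} → List A → List B → List (A × B)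
pairs xs ys = concatMap (λ x → map (λ y → (x , y)) ys) xs

record Multigraph (n m : ℕ) : Set where
  field
    tail : Fin m → Fin n
    head : Fin m → Fin n

NoSelfLoops : ∀ {n m} → Multigraph n m → Set
NoSelfLoops {m = m} G = (e : Fin m) → Multigraph.tail G e ≢ Multigraph.head G e

module Fp (p : ℕ) .{{_ : NonZero p}} where

  𝔽 : Set
  𝔽 = Fin p

  0𝔽 1𝔽 : 𝔽
  0𝔽 = 0 mod p
  1𝔽 = 1 mod p

  _+𝔽_ _*𝔽_ _-𝔽_ : 𝔽 → 𝔽 → 𝔽
  a +𝔽 b = (toℕ a + toℕ b) mod p
  a *𝔽 b = (toℕ a * toℕ b) mod p
  a -𝔽 b = (toℕ a + (p ∸ toℕ b)) mod p

  -𝔽_ : 𝔽 → 𝔽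
  -𝔽 a = 0𝔽 -𝔽 a

  Σ𝔽 : (n : ℕ) → (Fin n → 𝔽) → 𝔽
  Σ𝔽 zero    f = 0𝔽
  Σ𝔽 (suc n) f = f F.zero +𝔽 Σ𝔽 n (λ i → f (F.suc i))

  Mat : ℕ → ℕ → Set
  Mat r c = Fin r → Fin c → 𝔽

  _·_ : ∀ {r s c} → Mat r s → Mat s c → Mat r c
  _·_ {s = s} A B i j = Σ𝔽 s (λ l → A i l *𝔽 B l j)

  I : ∀ {r} → Mat r r
  I i j = if does (i ≟ j) then 1𝔽 else 0𝔽

  _−_ : ∀ {r c} → Mat r c → Mat r c → Mat r c
  (A − B) i j = A i j -𝔽 B i j

  sgn : ℕ → 𝔽
  sgn zero          = 1𝔽
  sgn (suc zero)    = -𝔽 1𝔽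
  sgn (suc (suc j)) = sgn j

  det : ∀ {r} → Mat r r → 𝔽
  det {zero}  M = 1𝔽
  det {suc r} M =
    Σ𝔽 (suc r) (λ j → (sgn (toℕ j) *𝔽 M F.zero j) *𝔽
                      det (λ a b → M (F.suc a) (punchIn j b)))

  -- The random matrices, given the values of the random entries:
  -- a i e = L_i[e, head e],  b i f = R_i[tail f, f].
  module _ {n m : ℕ} (G : Multigraph n m) (k : ℕ)
           (a b : Fin k → Fin m → 𝔽) where
    open Multigraph G

    Lmat : Fin k → Mat m n
    Lmat i e v = if does (v ≟ head e) then a i e else 0𝔽

    Rmat : Fin k → Mat n m
    Rmat i u f = if does (u ≟ tail f) then b i f else 0𝔽

    Kmat : Mat m m
    Kmat e f = Σ𝔽 k (λ i → (Lmat i · Rmat i) e f)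

  -- Sample space: all assignments of the independent uniform random entries
  -- (a, b); the uniform distribution on it is the product distribution.
  Ω : (k m : ℕ) → List ((Fin k → Fin m → 𝔽) × (Fin k → Fin m → 𝔽))
  Ω k m = pairs (allFns (allFns (allFin p) m) k) (allFns (allFns (allFin p) m) k)

  badOutcomes : ∀ {n m} → Multigraph n m → (k : ℕ) →
                List ((Fin k → Fin m → 𝔽) × (Fin k → Fin m → 𝔽))
  badOutcomes {m = m} G k =
    filter (λ { (a , b) → det (I − Kmat G k a b) ≟ 0𝔽 }) (Ω k m)

-- For fixed coefficients (a , b), the map c ↦ det (I − K (c·a , b)) is a polynomial
-- function of degree at most m, since every entry of I − K (c·a , b) is affine in c;
-- its value at c = 0 is det I = 1, so it has at most m roots in 𝔽_p.  Scaling a by a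
-- nonzero c permutes the sample space, so counting the pairs (c , ω) with c·ω bad in
-- two ways gives (p − 1) · #bad ≤ m · |Ω|, and p ≥ 2m⁵ turns this into #bad · m³ ≤ |Ω|.

module Submission where

open import Defs
open import Data.Nat using (ℕ; _*_; _^_; _≤_; NonZero)
open import Data.Nat.Primality using (Prime; prime⇒nonZero)
open import Data.List using (length)

open import Algebra.Bundles using (CommutativeRing)
open import Algebra.Consequences.Propositional
  using (comm∧idˡ⇒id; comm∧invʳ⇒inv; comm∧distrˡ⇒distrʳ; comm∧assoc⇒middleFour)
open import Algebra.Core using (Op₁; Op₂)
open import Algebra.Structures using (IsCommutativeRing)
open import Data.Bool using (true; false; if_then_else_)
open import Data.Empty using (⊥-elim)
open import Data.Fin using (Fin; zero; suc; toℕ; punchIn; punchOut; _≟_)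
open import Data.Fin.Permutation using (Permutation; permutation)
import Data.Fin.Properties as Fin
open import Data.List using (List; []; _∷_; filter; allFin; tabulate; map; concatMap; _++_)
open import Data.List.Relation.Unary.All using (All; _∷_; zipWith)
open import Data.List.Relation.Unary.All.Properties using (all-filter)
open import Data.List.Relation.Unary.AllPairs using (_∷_)
open import Data.List.Relation.Unary.Unique.Propositional using (Unique)
import Data.List.Relation.Unary.Unique.Propositional.Properties as Unique
open import Data.Nat using (zero; suc; z≤n; s≤s; _∸_; _%_; nonTrivial⇒n>1; >-nonZero⁻¹)
open import Data.Nat.DivMod using (_mod_; %-distribˡ-+; %-distribˡ-*; m%n%n≡m%n; m<n⇒m%n≡m; n%n≡0)
open import Data.Nat.Divisibility using (_∣_; m%n≡0⇒n∣m; n∣m⇒m%n≡0)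
open import Data.Nat.Primality using (euclidsLemma; prime⇒nonTrivial)
import Data.Nat.Properties as ℕ
import Algebra.Properties.CommutativeMonoid.Sum ℕ.+-0-commutativeMonoid as Sum
open import Data.Product using (Σ-syntax; ∃; _×_; _,_; proj₁; proj₂)
open import Data.Sum using (_⊎_; inj₁; inj₂; [_,_]′)
import Data.Sum as ⊎
open import Data.Vec.Functional using (Vector)
import Data.Vec.Functional as VF
open import Data.Vec.Functional.Relation.Binary.Pointwise using (Pointwise)
open import Function using (_∘_; id)
open import Function.Definitions using (Injective)
open import Level using (0ℓ)
open import Relation.Binary.Core using (Rel; _Preserves_⟶_)
open import Relation.Binary.Definitions using (Reflexive)
open import Relation.Binary.PropositionalEquality
open import Relation.Binary.PropositionalEquality.Properties using (isEquivalence)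
open import Algebra.Definitions {A = ℕ} _≡_ using (Commutative)
open import Relation.Nullary using (does; yes; no)
open import Relation.Unary using (Decidable)

module PolynomialFunctions
  {A : Set} {add mul : Op₂ A} {neg : Op₁ A} {0ₐ 1ₐ : A}
  (isCommutativeRing : IsCommutativeRing _≡_ add mul neg 0ₐ 1ₐ) where

  ring : CommutativeRing 0ℓ 0ℓ
  ring = record { isCommutativeRing = isCommutativeRing }

  open CommutativeRing ring
    using (_+_; _-_; 0#; +-identityˡ; +-identityʳ; -‿inverseʳ; zeroʳ; *-comm;
           +-abelianGroup; commutativeSemiring)
    renaming (_*_ to _·_)
  open import Algebra.Properties.AbelianGroup +-abelianGroup using (x∙y⁻¹≈ε⇒x≈y)
  open import Algebra.Properties.Ring (CommutativeRing.ring ring) using ([y-z]x≈yx-zx)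
  open import Algebra.Solver.Ring.NaturalCoefficients.Default commutativeSemiring
  open ≡-Reasoning

  -- Horner form; the function is only described pointwise, as there is no function
  -- extensionality.
  data HasDegree≤ : ℕ → (A → A) → Set where
    constant : ∀ {f} α → (∀ c → f c ≡ α) → HasDegree≤ 0 f
    horner   : ∀ {d f g} α → HasDegree≤ d g → (∀ c → f c ≡ α + c · g c) → HasDegree≤ (suc d) f

  hasDegree≤-cong : ∀ {d f g} → (∀ c → f c ≡ g c) → HasDegree≤ d f → HasDegree≤ d g
  hasDegree≤-cong f≗g (constant α f≡) = constant α (λ c → trans (sym (f≗g c)) (f≡ c))
  hasDegree≤-cong f≗g (horner α pg f≡) = horner α pg (λ c → trans (sym (f≗g c)) (f≡ c))

  private
    x≡x+y·0 : ∀ x y → x ≡ x + y · 0#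
    x≡x+y·0 x y = sym (trans (cong (x +_) (zeroʳ y)) (+-identityʳ x))

  const-hasDegree≤ : ∀ d α → HasDegree≤ d (λ _ → α)
  const-hasDegree≤ zero    α = constant α (λ _ → refl)
  const-hasDegree≤ (suc d) α = horner α (const-hasDegree≤ d 0#) (x≡x+y·0 α)

  hasDegree≤-suc : ∀ {d f} → HasDegree≤ d f → HasDegree≤ (suc d) f
  hasDegree≤-suc (constant α f≡) = horner α (constant 0# (λ _ → refl)) (λ c → trans (f≡ c) (x≡x+y·0 α c))
  hasDegree≤-suc (horner α pg f≡) = horner α (hasDegree≤-suc pg) f≡

  +-hasDegree≤ : ∀ {d f g} → HasDegree≤ d f → HasDegree≤ d g → HasDegree≤ d (λ c → f c + g c)
  +-hasDegree≤ (constant α f≡) (constant β g≡) = constant (α + β) (λ c → cong₂ _+_ (f≡ c) (g≡ c))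
  +-hasDegree≤ (horner {g = f′} α pf f≡) (horner {g = g′} β pg g≡) =
    horner (α + β) (+-hasDegree≤ pf pg) λ c → trans (cong₂ _+_ (f≡ c) (g≡ c))
      (solve 5 (λ α β c x y → (α :+ c :* x) :+ (β :+ c :* y) := (α :+ β) :+ c :* (x :+ y)) refl α β c (f′ c) (g′ c))

  ·-hasDegree≤ : ∀ {d f} β → HasDegree≤ d f → HasDegree≤ d (λ c → β · f c)
  ·-hasDegree≤ β (constant α f≡) = constant (β · α) (λ c → cong (β ·_) (f≡ c))
  ·-hasDegree≤ β (horner {g = g} α pg f≡) =
    horner (β · α) (·-hasDegree≤ β pg) λ c → trans (cong (β ·_) (f≡ c))
      (solve 4 (λ β α c y → β :* (α :+ c :* y) := β :* α :+ c :* (β :* y)) refl β α c (g c))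

  X·-hasDegree≤ : ∀ {d f} → HasDegree≤ d f → HasDegree≤ (suc d) (λ c → c · f c)
  X·-hasDegree≤ pf = horner 0# pf (λ c → sym (+-identityˡ _))

  affine·-hasDegree≤ : ∀ {d f} α β → HasDegree≤ d f → HasDegree≤ (suc d) (λ c → (α + c · β) · f c)
  affine·-hasDegree≤ {f = f} α β pf =
    hasDegree≤-cong
      (λ c → solve 4 (λ α β c x → α :* x :+ c :* (β :* x) := (α :+ c :* β) :* x) refl α β c (f c))
      (+-hasDegree≤ (hasDegree≤-suc (·-hasDegree≤ α pf)) (X·-hasDegree≤ (·-hasDegree≤ β pf)))

  -- f c = f r + (c − r) q c, with both sides moved so that no subtraction occurs (it is
  -- then a semiring identity).
  factor-theorem : ∀ {d f} → HasDegree≤ (suc d) f → ∀ r →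
                   Σ[ q ∈ (A → A) ] HasDegree≤ d q × (∀ c → f c + r · q c ≡ f r + c · q c)
  factor-theorem {f = f} (horner {g = g} α (constant γ g≡) f≡) r =
    (λ _ → γ) , constant γ (λ _ → refl) , λ c → begin
      f c + r · γ            ≡⟨ cong (_+ r · γ) (trans (f≡ c) (cong (λ y → α + c · y) (g≡ c))) ⟩
      (α + c · γ) + r · γ    ≡⟨ solve 4 (λ α c r γ → (α :+ c :* γ) :+ r :* γ := (α :+ r :* γ) :+ c :* γ) refl α c r γ ⟩
      (α + r · γ) + c · γ    ≡⟨ cong (_+ c · γ) (sym (trans (f≡ r) (cong (λ y → α + r · y) (g≡ r)))) ⟩
      f r + c · γ            ∎
  factor-theorem {f = f} (horner {g = g} α pg@(horner _ _ _) f≡) r with factor-theorem pg r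
  ... | q , pq , g≡ = (λ c → g r + c · q c) , horner (g r) pq (λ _ → refl) , λ c → begin
      f c + r · (g r + c · q c)                  ≡⟨ cong (_+ r · (g r + c · q c)) (f≡ c) ⟩
      (α + c · g c) + r · (g r + c · q c)        ≡⟨ solve 6 (λ α c r s t u → (α :+ c :* u) :+ r :* (s :+ c :* t)
                                                      := (α :+ r :* s) :+ c :* (u :+ r :* t)) refl α c r (g r) (q c) (g c) ⟩
      (α + r · g r) + c · (g c + r · q c)        ≡⟨ cong (λ y → (α + r · g r) + c · y) (g≡ c) ⟩
      (α + r · g r) + c · (g r + c · q c)        ≡⟨ cong (_+ c · (g r + c · q c)) (sym (f≡ r)) ⟩
      f r + c · (g r + c · q c)                  ∎

  module _ (noZeroDivisors : ∀ {x y} → x · y ≡ 0# → x ≡ 0# ⊎ y ≡ 0#) where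

    ·-cancelʳ-⊎ : ∀ {x y z} → x · z ≡ y · z → x ≡ y ⊎ z ≡ 0#
    ·-cancelʳ-⊎ {x} {y} {z} xz≡yz with noZeroDivisors (begin
        (x - y) · z    ≡⟨ [y-z]x≈yx-zx z x y ⟩
        x · z - y · z  ≡⟨ cong (_- y · z) xz≡yz ⟩
        y · z - y · z  ≡⟨ -‿inverseʳ (y · z) ⟩
        0#             ∎)
    ... | inj₁ x-y≡0 = inj₁ (x∙y⁻¹≈ε⇒x≈y x y x-y≡0)
    ... | inj₂ z≡0   = inj₂ z≡0

    ·-cancelˡ : ∀ {c x y} → c ≢ 0# → c · x ≡ c · y → x ≡ y
    ·-cancelˡ {c} {x} {y} c≢0 cx≡cy =
      [ (λ x≡y → x≡y) , ⊥-elim ∘ c≢0 ]′ (·-cancelʳ-⊎ (trans (*-comm x c) (trans cx≡cy (*-comm c y))))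

    roots≤degree : ∀ {d f} z → HasDegree≤ d f → f z ≢ 0# →
                   ∀ {rs} → Unique rs → All (λ x → f x ≡ 0#) rs → length rs ≤ d
    roots≤degree z pf fz≢0 {[]} _ _ = z≤n
    roots≤degree z (constant α f≡) fz≢0 {r ∷ _} _ (fr≡0 ∷ _) =
      ⊥-elim (fz≢0 (trans (f≡ z) (trans (sym (f≡ r)) fr≡0)))
    roots≤degree {f = f} z pf@(horner _ _ _) fz≢0 {r ∷ _} (r∉rs ∷ unique) (fr≡0 ∷ roots)
      with factor-theorem pf r
    ... | q , pq , f≡ = s≤s (roots≤degree z pq qz≢0 unique (zipWith q≡0 (r∉rs , roots)))
      where
        f+rq≡xq : ∀ x → f x + r · q x ≡ x · q x
        f+rq≡xq x = trans (f≡ x) (trans (cong (_+ x · q x) fr≡0) (+-identityˡ _))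

        qz≢0 : q z ≢ 0#
        qz≢0 qz≡0 = fz≢0 (begin
          f z             ≡⟨ x≡x+y·0 (f z) r ⟩
          f z + r · 0#    ≡⟨ cong (λ y → f z + r · y) (sym qz≡0) ⟩
          f z + r · q z   ≡⟨ f+rq≡xq z ⟩
          z · q z         ≡⟨ cong (z ·_) qz≡0 ⟩
          z · 0#          ≡⟨ zeroʳ z ⟩
          0#              ∎)

        q≡0 : ∀ {x} → r ≢ x × f x ≡ 0# → q x ≡ 0#
        q≡0 {x} (r≢x , fx≡0) =
          [ ⊥-elim ∘ r≢x , (λ qx≡0 → qx≡0) ]′
            (·-cancelʳ-⊎ (trans (sym (+-identityˡ _)) (trans (cong (_+ r · q x) (sym fx≡0)) (f+rq≡xq x))))

-- Only now, as it would clash with the ring addition inside PolynomialFunctions.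
open import Data.Nat using (_+_)

[m%d+n]%d≡[m+n]%d : ∀ m n d .{{_ : NonZero d}} → (m % d + n) % d ≡ (m + n) % d
[m%d+n]%d≡[m+n]%d m n d = begin
  (m % d + n) % d          ≡⟨ %-distribˡ-+ (m % d) n d ⟩
  (m % d % d + n % d) % d  ≡⟨ cong (λ x → (x + n % d) % d) (m%n%n≡m%n m d) ⟩
  (m % d + n % d) % d      ≡⟨ %-distribˡ-+ m n d ⟨
  (m + n) % d              ∎
  where open ≡-Reasoning

[m%d*n]%d≡[m*n]%d : ∀ m n d .{{_ : NonZero d}} → (m % d * n) % d ≡ (m * n) % d
[m%d*n]%d≡[m*n]%d m n d = begin
  (m % d * n) % d            ≡⟨ %-distribˡ-* (m % d) n d ⟩
  (m % d % d * (n % d)) % d  ≡⟨ cong (λ x → (x * (n % d)) % d) (m%n%n≡m%n m d) ⟩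
  (m % d * (n % d)) % d      ≡⟨ %-distribˡ-* m n d ⟨
  (m * n) % d                ∎
  where open ≡-Reasoning

module PrimeField (p : ℕ) (pr : Prime p) where

  instance
    p≢0 : NonZero p
    p≢0 = prime⇒nonZero pr

  open Fp p
  open import Algebra.Definitions {A = 𝔽} _≡_ using (Associative; LeftIdentity; RightInverse)
    renaming (Commutative to Commutative𝔽)
  open ≡-Reasoning

  toℕ-mod : ∀ n → toℕ (n mod p) ≡ n % p
  toℕ-mod n = Fin.toℕ-fromℕ< _

  toℕ%p≡toℕ : ∀ (x : 𝔽) → toℕ x % p ≡ toℕ x
  toℕ%p≡toℕ x = m<n⇒m%n≡m (Fin.toℕ<n x)

  toℕ-0𝔽 : toℕ 0𝔽 ≡ 0
  toℕ-0𝔽 = trans (toℕ-mod 0) (m<n⇒m%n≡m (>-nonZero⁻¹ p))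

  toℕ-1𝔽 : toℕ 1𝔽 ≡ 1
  toℕ-1𝔽 = trans (toℕ-mod 1) (m<n⇒m%n≡m (nonTrivial⇒n>1 p {{prime⇒nonTrivial pr}}))

  toℕ--𝔽 : ∀ x → toℕ (-𝔽 x) ≡ (p ∸ toℕ x) % p
  toℕ--𝔽 x = trans (toℕ-mod _) (cong (λ z → (z + (p ∸ toℕ x)) % p) toℕ-0𝔽)

  1𝔽≢0𝔽 : 1𝔽 ≢ 0𝔽
  1𝔽≢0𝔽 1≡0 with trans (sym toℕ-1𝔽) (trans (cong toℕ 1≡0) toℕ-0𝔽)
  ... | ()

  module Induced (_⋆_ : Op₂ ℕ) (⋆-comm : Commutative _⋆_)
                 (%-absorbˡ : ∀ m n → ((m % p) ⋆ n) % p ≡ (m ⋆ n) % p) where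

    _⊙_ : Op₂ 𝔽
    x ⊙ y = (toℕ x ⋆ toℕ y) mod p

    %-absorbʳ : ∀ m n → (m ⋆ (n % p)) % p ≡ (m ⋆ n) % p
    %-absorbʳ m n = trans (cong (_% p) (⋆-comm m _)) (trans (%-absorbˡ n m) (cong (_% p) (⋆-comm n m)))

    ⊙-comm : Commutative𝔽 _⊙_
    ⊙-comm x y = cong (_mod p) (⋆-comm (toℕ x) (toℕ y))

    ⊙-assoc : (∀ l m n → (l ⋆ m) ⋆ n ≡ l ⋆ (m ⋆ n)) → Associative _⊙_
    ⊙-assoc ⋆-assoc x y z = Fin.toℕ-injective (begin
      toℕ ((x ⊙ y) ⊙ z)                    ≡⟨ toℕ-mod _ ⟩
      (toℕ (x ⊙ y) ⋆ toℕ z) % p            ≡⟨ cong (λ w → (w ⋆ toℕ z) % p) (toℕ-mod _) ⟩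
      (((toℕ x ⋆ toℕ y) % p) ⋆ toℕ z) % p  ≡⟨ %-absorbˡ _ _ ⟩
      ((toℕ x ⋆ toℕ y) ⋆ toℕ z) % p        ≡⟨ cong (_% p) (⋆-assoc _ _ _) ⟩
      (toℕ x ⋆ (toℕ y ⋆ toℕ z)) % p        ≡⟨ %-absorbʳ _ _ ⟨
      (toℕ x ⋆ ((toℕ y ⋆ toℕ z) % p)) % p  ≡⟨ cong (λ w → (toℕ x ⋆ w) % p) (toℕ-mod _) ⟨
      (toℕ x ⋆ toℕ (y ⊙ z)) % p            ≡⟨ toℕ-mod _ ⟨
      toℕ (x ⊙ (y ⊙ z))                    ∎)

  private
    module +𝔽 = Induced _+_ ℕ.+-comm (λ m n → [m%d+n]%d≡[m+n]%d m n p)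
    module *𝔽 = Induced _*_ ℕ.*-comm (λ m n → [m%d*n]%d≡[m*n]%d m n p)

  +𝔽-identityˡ : LeftIdentity 0𝔽 _+𝔽_
  +𝔽-identityˡ x = Fin.toℕ-injective (begin
    toℕ (0𝔽 +𝔽 x)         ≡⟨ toℕ-mod _ ⟩
    (toℕ 0𝔽 + toℕ x) % p  ≡⟨ cong (λ z → (z + toℕ x) % p) toℕ-0𝔽 ⟩
    toℕ x % p             ≡⟨ toℕ%p≡toℕ x ⟩
    toℕ x                 ∎)

  *𝔽-identityˡ : LeftIdentity 1𝔽 _*𝔽_
  *𝔽-identityˡ x = Fin.toℕ-injective (begin
    toℕ (1𝔽 *𝔽 x)         ≡⟨ toℕ-mod _ ⟩
    (toℕ 1𝔽 * toℕ x) % p  ≡⟨ cong (λ z → (z * toℕ x) % p) toℕ-1𝔽 ⟩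
    (1 * toℕ x) % p       ≡⟨ cong (_% p) (ℕ.*-identityˡ (toℕ x)) ⟩
    toℕ x % p             ≡⟨ toℕ%p≡toℕ x ⟩
    toℕ x                 ∎)

  -𝔽-inverseʳ : RightInverse 0𝔽 -𝔽_ _+𝔽_
  -𝔽-inverseʳ x = Fin.toℕ-injective (begin
    toℕ (x +𝔽 (-𝔽 x))               ≡⟨ toℕ-mod _ ⟩
    (toℕ x + toℕ (-𝔽 x)) % p        ≡⟨ cong (λ z → (toℕ x + z) % p) (toℕ--𝔽 x) ⟩
    (toℕ x + (p ∸ toℕ x) % p) % p   ≡⟨ +𝔽.%-absorbʳ (toℕ x) (p ∸ toℕ x) ⟩
    (toℕ x + (p ∸ toℕ x)) % p       ≡⟨ cong (_% p) (ℕ.m+[n∸m]≡n (ℕ.<⇒≤ (Fin.toℕ<n x))) ⟩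
    p % p                           ≡⟨ n%n≡0 p ⟩
    0                               ≡⟨ toℕ-0𝔽 ⟨
    toℕ 0𝔽                         ∎)

  -𝔽-sub : ∀ x y → x -𝔽 y ≡ x +𝔽 (-𝔽 y)
  -𝔽-sub x y = Fin.toℕ-injective (begin
    toℕ (x -𝔽 y)                     ≡⟨ toℕ-mod _ ⟩
    (toℕ x + (p ∸ toℕ y)) % p        ≡⟨ +𝔽.%-absorbʳ (toℕ x) (p ∸ toℕ y) ⟨
    (toℕ x + (p ∸ toℕ y) % p) % p    ≡⟨ cong (λ z → (toℕ x + z) % p) (toℕ--𝔽 y) ⟨
    (toℕ x + toℕ (-𝔽 y)) % p         ≡⟨ toℕ-mod _ ⟨
    toℕ (x +𝔽 (-𝔽 y))                ∎)

  *𝔽-distribˡ-+𝔽 : ∀ x y z → x *𝔽 (y +𝔽 z) ≡ (x *𝔽 y) +𝔽 (x *𝔽 z)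
  *𝔽-distribˡ-+𝔽 x y z = Fin.toℕ-injective (begin
    toℕ (x *𝔽 (y +𝔽 z))                            ≡⟨ toℕ-mod _ ⟩
    (toℕ x * toℕ (y +𝔽 z)) % p                     ≡⟨ cong (λ w → (toℕ x * w) % p) (toℕ-mod _) ⟩
    (toℕ x * ((toℕ y + toℕ z) % p)) % p            ≡⟨ *𝔽.%-absorbʳ (toℕ x) _ ⟩
    (toℕ x * (toℕ y + toℕ z)) % p                  ≡⟨ cong (_% p) (ℕ.*-distribˡ-+ (toℕ x) (toℕ y) _) ⟩
    (toℕ x * toℕ y + toℕ x * toℕ z) % p            ≡⟨ %-distribˡ-+ (toℕ x * toℕ y) _ p ⟩
    ((toℕ x * toℕ y) % p + (toℕ x * toℕ z) % p) % p ≡⟨ cong₂ (λ u v → (u + v) % p) (toℕ-mod _) (toℕ-mod _) ⟨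
    (toℕ (x *𝔽 y) + toℕ (x *𝔽 z)) % p               ≡⟨ toℕ-mod _ ⟨
    toℕ ((x *𝔽 y) +𝔽 (x *𝔽 z))                      ∎)

  +-*-isCommutativeRing : IsCommutativeRing _≡_ _+𝔽_ _*𝔽_ -𝔽_ 0𝔽 1𝔽
  +-*-isCommutativeRing = record
    { isRing = record
      { +-isAbelianGroup = record
        { isGroup = record
          { isMonoid = record
            { isSemigroup = record
              { isMagma = record { isEquivalence = isEquivalence ; ∙-cong = cong₂ _+𝔽_ }
              ; assoc = +𝔽.⊙-assoc ℕ.+-assoc }
            ; identity = comm∧idˡ⇒id +𝔽.⊙-comm +𝔽-identityˡ }
          ; inverse = comm∧invʳ⇒inv +𝔽.⊙-comm -𝔽-inverseʳ
          ; ⁻¹-cong = cong (-𝔽_) }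
        ; comm = +𝔽.⊙-comm }
      ; *-cong = cong₂ _*𝔽_
      ; *-assoc = *𝔽.⊙-assoc ℕ.*-assoc
      ; *-identity = comm∧idˡ⇒id *𝔽.⊙-comm *𝔽-identityˡ
      ; distrib = *𝔽-distribˡ-+𝔽 , comm∧distrˡ⇒distrʳ *𝔽.⊙-comm *𝔽-distribˡ-+𝔽 }
    ; *-comm = *𝔽.⊙-comm }

  *𝔽-noZeroDivisors : ∀ {x y} → x *𝔽 y ≡ 0𝔽 → x ≡ 0𝔽 ⊎ y ≡ 0𝔽
  *𝔽-noZeroDivisors {x} {y} xy≡0 =
    ⊎.map p∣⇒≡0𝔽 p∣⇒≡0𝔽 (euclidsLemma (toℕ x) (toℕ y) pr
      (m%n≡0⇒n∣m _ p (trans (sym (toℕ-mod _)) (trans (cong toℕ xy≡0) toℕ-0𝔽))))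
    where
      p∣⇒≡0𝔽 : ∀ {z} → p ∣ toℕ z → z ≡ 0𝔽
      p∣⇒≡0𝔽 {z} p∣z = Fin.toℕ-injective (trans (sym (toℕ%p≡toℕ z)) (trans (n∣m⇒m%n≡0 _ p p∣z) (sym toℕ-0𝔽)))

  open PolynomialFunctions +-*-isCommutativeRing
  open CommutativeRing ring
    using (*-assoc; *-identityʳ; zeroˡ; zeroʳ; distribˡ; +-identityʳ; commutativeSemiring)
  open import Algebra.Properties.Ring (CommutativeRing.ring ring) using (-‿distribʳ-*)
  open import Algebra.Solver.Ring.NaturalCoefficients.Default commutativeSemiring

  Σ𝔽-cong : ∀ n {x y : Fin n → 𝔽} → (∀ i → x i ≡ y i) → Σ𝔽 n x ≡ Σ𝔽 n y
  Σ𝔽-cong zero    x≗y = refl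
  Σ𝔽-cong (suc n) x≗y = cong₂ _+𝔽_ (x≗y zero) (Σ𝔽-cong n (x≗y ∘ suc))

  Σ𝔽-zero : ∀ n {x : Fin n → 𝔽} → (∀ i → x i ≡ 0𝔽) → Σ𝔽 n x ≡ 0𝔽
  Σ𝔽-zero zero    x≗0 = refl
  Σ𝔽-zero (suc n) x≗0 = trans (cong₂ _+𝔽_ (x≗0 zero) (Σ𝔽-zero n (x≗0 ∘ suc))) (+-identityʳ 0𝔽)

  *𝔽-distribˡ-Σ𝔽 : ∀ n c (x : Fin n → 𝔽) → c *𝔽 Σ𝔽 n x ≡ Σ𝔽 n (λ i → c *𝔽 x i)
  *𝔽-distribˡ-Σ𝔽 zero    c x = zeroʳ c
  *𝔽-distribˡ-Σ𝔽 (suc n) c x = trans (distribˡ c (x zero) _) (cong ((c *𝔽 x zero) +𝔽_) (*𝔽-distribˡ-Σ𝔽 n c (x ∘ suc)))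

  Σ𝔽-hasDegree≤ : ∀ {d} n {F : 𝔽 → Fin n → 𝔽} →
                  (∀ i → HasDegree≤ d (λ c → F c i)) → HasDegree≤ d (λ c → Σ𝔽 n (F c))
  Σ𝔽-hasDegree≤ zero    _  = const-hasDegree≤ _ 0𝔽
  Σ𝔽-hasDegree≤ (suc n) pF = +-hasDegree≤ (pF zero) (Σ𝔽-hasDegree≤ n (pF ∘ suc))

  minor : ∀ {r} → Mat (suc r) (suc r) → Fin (suc r) → Mat r r
  minor M j a b = M (suc a) (punchIn j b)

  det-cong : ∀ r {M N : Mat r r} → (∀ i j → M i j ≡ N i j) → det M ≡ det N
  det-cong zero    _   = refl
  det-cong (suc r) M≗N = Σ𝔽-cong (suc r) λ j →
    cong₂ _*𝔽_ (cong (sgn (toℕ j) *𝔽_) (M≗N zero j)) (det-cong r (λ a b → M≗N (suc a) (punchIn j b)))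

  det-I : ∀ r → det (I {r}) ≡ 1𝔽
  det-I zero    = refl
  det-I (suc r) = begin
    ((1𝔽 *𝔽 1𝔽) *𝔽 det (minor (I {suc r}) zero)) +𝔽 Σ𝔽 r (λ j → (sgn (suc (toℕ j)) *𝔽 0𝔽) *𝔽 det (minor I (suc j)))
      ≡⟨ cong₂ _+𝔽_ (trans (cong ((1𝔽 *𝔽 1𝔽) *𝔽_) (trans (det-cong r {N = I} (λ _ _ → refl)) (det-I r)))
                           (trans (*-identityʳ _) (*-identityʳ 1𝔽)))
                    (Σ𝔽-zero r (λ j → trans (cong (_*𝔽 det (minor I (suc j))) (zeroʳ (sgn (suc (toℕ j))))) (zeroˡ _))) ⟩
    1𝔽 +𝔽 0𝔽
      ≡⟨ +-identityʳ 1𝔽 ⟩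
    1𝔽 ∎

  det-affine-hasDegree≤ : ∀ r {M : 𝔽 → Mat r r} (α β : Mat r r) →
                          (∀ c i j → M c i j ≡ α i j +𝔽 (c *𝔽 β i j)) → HasDegree≤ r (λ c → det (M c))
  det-affine-hasDegree≤ zero    α β _  = constant 1𝔽 (λ _ → refl)
  det-affine-hasDegree≤ (suc r) {M} α β M≡ = Σ𝔽-hasDegree≤ (suc r) λ j →
    hasDegree≤-cong (λ c → cong (_*𝔽 det (minor (M c) j)) (sym (signed-entry c j)))
      (affine·-hasDegree≤ (sgn (toℕ j) *𝔽 α zero j) (sgn (toℕ j) *𝔽 β zero j)
        (det-affine-hasDegree≤ r (minor α j) (minor β j) (λ c a b → M≡ c (suc a) (punchIn j b))))
    where
      signed-entry : ∀ c j → sgn (toℕ j) *𝔽 M c zero j ≡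
                             (sgn (toℕ j) *𝔽 α zero j) +𝔽 (c *𝔽 (sgn (toℕ j) *𝔽 β zero j))
      signed-entry c j = trans (cong (sgn (toℕ j) *𝔽_) (M≡ c zero j))
        (solve 4 (λ s a c b → s :* (a :+ c :* b) := s :* a :+ c :* (s :* b)) refl (sgn (toℕ j)) (α zero j) c (β zero j))

  Coeffs : ℕ → ℕ → Set
  Coeffs k m = Fin k → Fin m → 𝔽

  _•_ : ∀ {k m} → 𝔽 → Coeffs k m → Coeffs k m
  (c • a) i e = c *𝔽 a i e

  module _ {n m} (G : Multigraph n m) (k : ℕ) where
    open Multigraph G

    Lmat-• : ∀ c a b i e v → Lmat G k (c • a) b i e v ≡ c *𝔽 Lmat G k a b i e v
    Lmat-• c a b i e v with does (v ≟ head e)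
    ... | true  = refl
    ... | false = sym (zeroʳ c)

    Lmat-cong : ∀ {a a′} b → (∀ i e → a i e ≡ a′ i e) → ∀ i e v → Lmat G k a b i e v ≡ Lmat G k a′ b i e v
    Lmat-cong b a≗a′ i e v with does (v ≟ head e)
    ... | true  = a≗a′ i e
    ... | false = refl

    Kmat-cong : ∀ {a a′} b → (∀ i e → a i e ≡ a′ i e) → ∀ e f → Kmat G k a b e f ≡ Kmat G k a′ b e f
    Kmat-cong {a} b a≗a′ e f =
      Σ𝔽-cong k λ i → Σ𝔽-cong n λ v → cong (_*𝔽 Rmat G k a b i v f) (Lmat-cong b a≗a′ i e v)

    Kmat-• : ∀ c a b e f → Kmat G k (c • a) b e f ≡ c *𝔽 Kmat G k a b e f
    Kmat-• c a b e f = begin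
      Σ𝔽 k (λ i → Σ𝔽 n (λ v → Lmat G k (c • a) b i e v *𝔽 Rmat G k (c • a) b i v f))
        ≡⟨ Σ𝔽-cong k (λ i → Σ𝔽-cong n (λ v →
             trans (cong (_*𝔽 Rmat G k a b i v f) (Lmat-• c a b i e v)) (*-assoc c _ _))) ⟩
      Σ𝔽 k (λ i → Σ𝔽 n (λ v → c *𝔽 (Lmat G k a b i e v *𝔽 Rmat G k a b i v f)))
        ≡⟨ Σ𝔽-cong k (λ i → sym (*𝔽-distribˡ-Σ𝔽 n c _)) ⟩
      Σ𝔽 k (λ i → c *𝔽 Σ𝔽 n (λ v → Lmat G k a b i e v *𝔽 Rmat G k a b i v f))
        ≡⟨ *𝔽-distribˡ-Σ𝔽 k c _ ⟨
      c *𝔽 Kmat G k a b e f ∎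

    I−K-affine : ∀ c a b e f → (I − Kmat G k (c • a) b) e f ≡ I e f +𝔽 (c *𝔽 (-𝔽 Kmat G k a b e f))
    I−K-affine c a b e f = begin
      I e f -𝔽 Kmat G k (c • a) b e f        ≡⟨ -𝔽-sub (I e f) (Kmat G k (c • a) b e f) ⟩
      I e f +𝔽 (-𝔽 Kmat G k (c • a) b e f)   ≡⟨ cong (λ x → I e f +𝔽 (-𝔽 x)) (Kmat-• c a b e f) ⟩
      I e f +𝔽 (-𝔽 (c *𝔽 Kmat G k a b e f))  ≡⟨ cong (I e f +𝔽_) (-‿distribʳ-* c (Kmat G k a b e f)) ⟩
      I e f +𝔽 (c *𝔽 (-𝔽 Kmat G k a b e f))  ∎

    singularScalings≤m : ∀ a b →
      length (filter (λ c → det (I − Kmat G k (c • a) b) ≟ 0𝔽) (allFin p)) ≤ m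
    singularScalings≤m a b =
      roots≤degree *𝔽-noZeroDivisors 0𝔽
        (det-affine-hasDegree≤ m I (λ e f → -𝔽 Kmat G k a b e f) (λ c → I−K-affine c a b))
        det[I−0K]≢0 (Unique.filter⁺ singular? (Unique.allFin⁺ p)) (all-filter singular? (allFin p))
      where
        singular? : Decidable (λ c → det (I − Kmat G k (c • a) b) ≡ 0𝔽)
        singular? c = det (I − Kmat G k (c • a) b) ≟ 0𝔽

        det[I−0K]≢0 : det (I − Kmat G k (0𝔽 • a) b) ≢ 0𝔽
        det[I−0K]≢0 det≡0 = 1𝔽≢0𝔽 (begin
          1𝔽                              ≡⟨ det-I m ⟨
          det (I {m})                     ≡⟨ det-cong m (λ e f → sym (trans (I−K-affine 0𝔽 a b e f)
                                               (trans (cong (I e f +𝔽_) (zeroˡ _)) (+-identityʳ _)))) ⟩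
          det (I − Kmat G k (0𝔽 • a) b)   ≡⟨ det≡0 ⟩
          0𝔽                              ∎)

∑ : {X : Set} → List X → (X → ℕ) → ℕ
∑ []       F = 0
∑ (x ∷ xs) F = F x + ∑ xs F

syntax ∑ xs (λ x → e) = ∑[ x ∈ xs ] e

private variable
  X Y : Set

indicator : {P : X → Set} → Decidable P → X → ℕ
indicator P? x = if does (P? x) then 1 else 0

length-filter : ∀ {P : X → Set} (P? : Decidable P) xs → length (filter P? xs) ≡ ∑ xs (indicator P?)
length-filter P? []       = refl
length-filter P? (x ∷ xs) with does (P? x)
... | true  = cong suc (length-filter P? xs)
... | false = length-filter P? xs

∑-cong : ∀ {F G : X → ℕ} → (∀ x → F x ≡ G x) → ∀ xs → ∑ xs F ≡ ∑ xs G
∑-cong F≗G []       = refl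
∑-cong F≗G (x ∷ xs) = cong₂ _+_ (F≗G x) (∑-cong F≗G xs)

∑-mono-≤ : ∀ {F G : X → ℕ} → (∀ x → F x ≤ G x) → ∀ xs → ∑ xs F ≤ ∑ xs G
∑-mono-≤ F≤G []       = z≤n
∑-mono-≤ F≤G (x ∷ xs) = ℕ.+-mono-≤ (F≤G x) (∑-mono-≤ F≤G xs)

∑-const : ∀ c (xs : List X) → ∑[ _ ∈ xs ] c ≡ length xs * c
∑-const c []       = refl
∑-const c (x ∷ xs) = cong (c +_) (∑-const c xs)

∑-+ : ∀ (F G : X → ℕ) xs → ∑[ x ∈ xs ] (F x + G x) ≡ ∑ xs F + ∑ xs G
∑-+ F G []       = refl
∑-+ F G (x ∷ xs) = trans (cong (F x + G x +_) (∑-+ F G xs)) (comm∧assoc⇒middleFour ℕ.+-comm ℕ.+-assoc (F x) (G x) _ _)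

∑-++ : ∀ (F : X → ℕ) xs ys → ∑ (xs ++ ys) F ≡ ∑ xs F + ∑ ys F
∑-++ F []       ys = refl
∑-++ F (x ∷ xs) ys = trans (cong (F x +_) (∑-++ F xs ys)) (sym (ℕ.+-assoc (F x) _ _))

∑-map : ∀ (F : Y → ℕ) (g : X → Y) xs → ∑ (map g xs) F ≡ ∑[ x ∈ xs ] F (g x)
∑-map F g []       = refl
∑-map F g (x ∷ xs) = cong (F (g x) +_) (∑-map F g xs)

∑-tabulate-≥ : ∀ {n} (F : X → ℕ) (g : Fin n → X) B → (∀ i → B ≤ F (g i)) → n * B ≤ ∑ (tabulate g) F
∑-tabulate-≥ {n = zero}  F g B B≤ = z≤n
∑-tabulate-≥ {n = suc n} F g B B≤ = ℕ.+-mono-≤ (B≤ zero) (∑-tabulate-≥ F (g ∘ suc) B (B≤ ∘ suc))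

∑-concatMap : ∀ (F : Y → ℕ) (g : X → List Y) xs → ∑ (concatMap g xs) F ≡ ∑[ x ∈ xs ] ∑ (g x) F
∑-concatMap F g []       = refl
∑-concatMap F g (x ∷ xs) = trans (∑-++ F (g x) (concatMap g xs)) (cong (∑ (g x) F +_) (∑-concatMap F g xs))

∑-pairs : ∀ (F : X × Y → ℕ) xs ys → ∑ (pairs xs ys) F ≡ ∑[ x ∈ xs ] ∑[ y ∈ ys ] F (x , y)
∑-pairs F xs ys = trans (∑-concatMap F _ xs) (∑-cong (λ x → ∑-map F (x ,_) ys) xs)

∑-swap : ∀ (F : X → Y → ℕ) xs ys → ∑[ x ∈ xs ] ∑[ y ∈ ys ] F x y ≡ ∑[ y ∈ ys ] ∑[ x ∈ xs ] F x y
∑-swap F []       ys = sym (trans (∑-const 0 ys) (ℕ.*-zeroʳ (length ys)))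
∑-swap F (x ∷ xs) ys = trans (cong (∑ ys (F x) +_) (∑-swap F xs ys)) (sym (∑-+ (F x) _ ys))

-- σ permutes xs up to ≈, stated through sums since functions are only compared pointwise.
SumInvariant : List X → Rel X 0ℓ → (X → X) → Set
SumInvariant xs _≈_ σ = ∀ F → F Preserves _≈_ ⟶ _≡_ → ∑ xs (F ∘ σ) ≡ ∑ xs F

∑-allFns-suc : ∀ (xs : List X) n (F : Vector X (suc n) → ℕ) →
               ∑ (allFns xs (suc n)) F ≡ ∑[ x ∈ xs ] ∑[ f ∈ allFns xs n ] F (x VF.∷ f)
∑-allFns-suc xs n F = trans (∑-concatMap F _ xs) (∑-cong (λ x → ∑-map F (x VF.∷_) (allFns xs n)) xs)

allFns-sumInvariant : ∀ {xs : List X} {_≈_ σ} → Reflexive _≈_ → SumInvariant xs _≈_ σ →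
                      ∀ n → SumInvariant (allFns xs n) (Pointwise _≈_) (σ ∘_)
allFns-sumInvariant ≈-refl inv zero    F F-resp = cong (_+ 0) (F-resp (λ ()))
allFns-sumInvariant {xs = xs} {_≈_} {σ} ≈-refl inv (suc n) F F-resp = begin
  ∑ (allFns xs (suc n)) (F ∘ (σ ∘_))                     ≡⟨ ∑-allFns-suc xs n _ ⟩
  ∑[ x ∈ xs ] ∑[ f ∈ allFns xs n ] F (σ ∘ (x VF.∷ f))    ≡⟨ ∑-cong (λ x → ∑-cong (λ f → F-resp (σ∘∷ x f)) (allFns xs n)) xs ⟩
  ∑[ x ∈ xs ] ∑[ f ∈ allFns xs n ] F (σ x VF.∷ (σ ∘ f))  ≡⟨ ∑-cong (λ x → allFns-sumInvariant ≈-refl inv n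
                                                              (λ f → F (σ x VF.∷ f)) (F-resp ∘ ∷-cong ≈-refl)) xs ⟩
  ∑[ x ∈ xs ] ∑[ f ∈ allFns xs n ] F (σ x VF.∷ f)        ≡⟨ inv (λ y → ∑[ f ∈ allFns xs n ] F (y VF.∷ f))
                                                              (λ x≈y → ∑-cong (λ f → F-resp (∷-cong x≈y (λ _ → ≈-refl))) (allFns xs n)) ⟩
  ∑[ x ∈ xs ] ∑[ f ∈ allFns xs n ] F (x VF.∷ f)          ≡⟨ ∑-allFns-suc xs n F ⟨
  ∑ (allFns xs (suc n)) F                                ∎
  where
    open ≡-Reasoning

    σ∘∷ : ∀ x (f : Vector _ n) → Pointwise _≈_ (σ ∘ (x VF.∷ f)) (σ x VF.∷ (σ ∘ f))
    σ∘∷ x f zero    = ≈-refl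
    σ∘∷ x f (suc i) = ≈-refl

    ∷-cong : ∀ {x y} {f g : Vector _ n} → x ≈ y → Pointwise _≈_ f g → Pointwise _≈_ (x VF.∷ f) (y VF.∷ g)
    ∷-cong x≈y f≈g zero    = x≈y
    ∷-cong x≈y f≈g (suc i) = f≈g i

injective⇒surjective : ∀ {n} {σ : Fin n → Fin n} → Injective _≡_ _≡_ σ → ∀ y → ∃ λ x → σ x ≡ y
injective⇒surjective {suc n} {σ} σ-inj y with Fin.any? (λ x → σ x ≟ y)
... | yes hit = hit
... | no miss = ⊥-elim (ℕ.<-irrefl refl (Fin.injective⇒≤ {f = τ} τ-inj))
  where
    y≢σ : ∀ x → y ≢ σ x
    y≢σ x y≡σx = miss (x , sym y≡σx)

    τ : Fin (suc n) → Fin n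
    τ x = punchOut (y≢σ x)

    τ-inj : Injective _≡_ _≡_ τ
    τ-inj τx≡τz = σ-inj (Fin.punchOut-injective (y≢σ _) (y≢σ _) τx≡τz)

∑-tabulate : ∀ {n} (F : X → ℕ) (g : Fin n → X) → ∑ (tabulate g) F ≡ Sum.sum (F ∘ g)
∑-tabulate {n = zero}  F g = refl
∑-tabulate {n = suc n} F g = cong (F (g zero) +_) (∑-tabulate F (g ∘ suc))

injective⇒sumInvariant : ∀ {n} {σ : Fin n → Fin n} → Injective _≡_ _≡_ σ → SumInvariant (allFin n) _≡_ σ
injective⇒sumInvariant {n} {σ} σ-inj F _ = begin
  ∑ (allFin n) (F ∘ σ)  ≡⟨ ∑-tabulate (F ∘ σ) id ⟩
  Sum.sum (F ∘ σ)       ≡⟨ Sum.sum-permute F π ⟨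
  Sum.sum F             ≡⟨ ∑-tabulate F id ⟨
  ∑ (allFin n) F        ∎
  where
    open ≡-Reasoning

    σ⁻¹ : Fin n → Fin n
    σ⁻¹ y = proj₁ (injective⇒surjective σ-inj y)

    π : Permutation n n
    π = permutation σ σ⁻¹ (λ y → proj₂ (injective⇒surjective σ-inj y)) (λ x → σ-inj (proj₂ (injective⇒surjective σ-inj (σ x))))

module DoubleCounting (p′ : ℕ) (pr : Prime (suc p′)) {n m} (G : Multigraph n m) (k : ℕ) where

  open PrimeField (suc p′) pr
  open PolynomialFunctions +-*-isCommutativeRing using (·-cancelˡ)
  open Fp (suc p′)

  Outcome : Set
  Outcome = Coeffs k m × Coeffs k m

  singular : Outcome → ℕ
  singular (a , b) = if does (det (I − Kmat G k a b) ≟ 0𝔽) then 1 else 0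

  scale : 𝔽 → Outcome → Outcome
  scale c (a , b) = c • a , b

  #bad≡∑singular : length (badOutcomes G k) ≡ ∑ (Ω k m) singular
  #bad≡∑singular = trans (length-filter _ (Ω k m)) (∑-cong (λ { (a , b) → refl }) (Ω k m))

  scale-sumInvariant : ∀ {c} → c ≢ 0𝔽 → ∑[ ω ∈ Ω k m ] singular (scale c ω) ≡ ∑ (Ω k m) singular
  scale-sumInvariant {c} c≢0 = begin
    ∑[ ω ∈ Ω k m ] singular (scale c ω)              ≡⟨ ∑-pairs _ A A ⟩
    ∑[ a ∈ A ] ∑[ b ∈ A ] singular (c • a , b)     ≡⟨ •-sumInvariant (λ a → ∑[ b ∈ A ] singular (a , b)) row-resp ⟩
    ∑[ a ∈ A ] ∑[ b ∈ A ] singular (a , b)         ≡⟨ ∑-pairs _ A A ⟨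
    ∑ (Ω k m) singular                             ∎
    where
      open ≡-Reasoning

      A : List (Coeffs k m)
      A = allFns (allFns (allFin (suc p′)) m) k

      •-sumInvariant : SumInvariant A (Pointwise (Pointwise _≡_)) (c •_)
      •-sumInvariant = allFns-sumInvariant (λ _ → refl)
        (allFns-sumInvariant refl (injective⇒sumInvariant (·-cancelˡ *𝔽-noZeroDivisors c≢0)) m) k

      row-resp : (λ a → ∑[ b ∈ A ] singular (a , b)) Preserves Pointwise (Pointwise _≡_) ⟶ _≡_
      row-resp a≈a′ = ∑-cong (λ b → cong (λ d → if does (d ≟ 0𝔽) then 1 else 0)
        (det-cong m (λ e f → cong (λ x → I e f -𝔽 x) (Kmat-cong G k b a≈a′ e f)))) A

  ∑-singular∘scale≤m : ∀ ω → ∑[ c ∈ allFin (suc p′) ] singular (scale c ω) ≤ m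
  ∑-singular∘scale≤m (a , b) = subst (_≤ m) (length-filter _ (allFin (suc p′))) (singularScalings≤m G k a b)

  p′*#bad≤#Ω*m : p′ * length (badOutcomes G k) ≤ length (Ω k m) * m
  p′*#bad≤#Ω*m = begin
    p′ * length (badOutcomes G k)                                  ≡⟨ cong (p′ *_) #bad≡∑singular ⟩
    p′ * ∑ (Ω k m) singular                                         ≤⟨ ∑-tabulate-≥ scaledCount suc _
                                                                         (λ i → ℕ.≤-reflexive (sym (scale-sumInvariant (suc≢0𝔽 i)))) ⟩
    ∑[ c ∈ tabulate suc ] scaledCount c                             ≤⟨ ℕ.m≤n+m _ (scaledCount zero) ⟩
    ∑[ c ∈ allFin (suc p′) ] scaledCount c                          ≡⟨ ∑-swap (λ c ω → singular (scale c ω)) (allFin (suc p′)) (Ω k m) ⟩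
    ∑[ ω ∈ Ω k m ] ∑[ c ∈ allFin (suc p′) ] singular (scale c ω)    ≤⟨ ∑-mono-≤ ∑-singular∘scale≤m (Ω k m) ⟩
    ∑[ _ ∈ Ω k m ] m                                                ≡⟨ ∑-const m (Ω k m) ⟩
    length (Ω k m) * m                                              ∎
    where
      open ℕ.≤-Reasoning

      scaledCount : 𝔽 → ℕ
      scaledCount c = ∑[ ω ∈ Ω k m ] singular (scale c ω)

      suc≢0𝔽 : ∀ i → suc i ≢ 0𝔽
      suc≢0𝔽 i suc≡0 = ℕ.1+n≢0 (trans (cong toℕ suc≡0) toℕ-0𝔽)

cube-bound : ∀ m p′ B N → 2 * m ^ 5 ≤ suc p′ → p′ * B ≤ N * m → B * m ^ 3 ≤ N
cube-bound zero      p′ B N _ _ = subst (_≤ N) (sym (ℕ.*-zeroʳ B)) z≤n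
cube-bound m@(suc _) p′ B N 2m⁵≤1+p′ p′B≤Nm = ℕ.*-cancelˡ-≤ m (begin
  m * (B * m ^ 3)  ≡⟨ solve 2 (λ m B → m :* (B :* m :^ 3) := B :* m :^ 4) refl m B ⟩
  B * m ^ 4        ≤⟨ ℕ.*-monoʳ-≤ B m⁴≤p′ ⟩
  B * p′           ≡⟨ ℕ.*-comm B p′ ⟩
  p′ * B           ≤⟨ p′B≤Nm ⟩
  N * m            ≡⟨ ℕ.*-comm N m ⟩
  m * N            ∎)
  where
    open ℕ.≤-Reasoning
    open import Data.Nat.Solver using (module +-*-Solver)
    open +-*-Solver

    m⁴≤p′ : m ^ 4 ≤ p′
    m⁴≤p′ = ℕ.≤-pred (begin
      1 + m ^ 4        ≤⟨ ℕ.+-mono-≤ (ℕ.m^n>0 m 5) (ℕ.m≤n*m (m ^ 4) m) ⟩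
      m ^ 5 + m ^ 5    ≡⟨ cong (m ^ 5 +_) (ℕ.+-identityʳ (m ^ 5)) ⟨
      2 * m ^ 5        ≤⟨ 2m⁵≤1+p′ ⟩
      suc p′           ∎)

lemma7 : {n m : ℕ} (G : Multigraph n m) → NoSelfLoops G →
         (k : ℕ) → 1 ≤ k →
         (p : ℕ) (pr : Prime p) → 2 * m ^ 5 ≤ p →
         length (Fp.badOutcomes p {{prime⇒nonZero pr}} G k) * m ^ 3
           ≤ length (Fp.Ω p {{prime⇒nonZero pr}} k m)
lemma7         G _ k _ zero     ()
lemma7 {m = m} G _ k _ (suc p′) pr 2m⁵≤p = cube-bound m p′ _ _ 2m⁵≤p (DoubleCounting.p′*#bad≤#Ω*m p′ pr G k)
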